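{- Let $\pi\in res_n(\tilde{\mathcal{A}})$ for some $n\ge1$, and let $t$ be the binary increasing tree with $n$ nodes such that $\psi(t)=\pi$. Then the set $L(\pi)$ of left-to-right minima of $\pi$ is exactly the set of labels of the nodes on the min-path of $t$.
   Context: A binary increasing tree with $n$ nodes is a rooted tree (children unordered) in which every node has $0$, $1$ or $2$ children, whose nodes are labelled bijectively by $\{1,\dots,n\}$ so that labels strictly increase along every root-to-leaf path; it is strictly binary if no node has exactly one child. In the standard drawing, a node with two children has the smaller-labelled child on its left and the larger on its right, and a node with one child has it on its right; in the left-oriented drawing the same holds except that a node with one child has it on its left. $\phi(t)$ (resp. $\psi(t)$) is the permutation obtained by reading the labels of the standard (resp. left-oriented) drawing of $t$ in in-order (left subtree, node, right subtree). $\tilde{\mathcal{A}}$ is the set of all $\phi(t)$ with $t$ strictly binary increasing (any size). For $\pi\in\mathcal{S}_N$ and $1\le k\le N$, the restriction of $\pi$ to $\{1,\dots,k\}$ is obtained from $\pi_1\cdots\pi_N$ by deleting entries larger than $k$; write $\sigma\lhd\pi$. $res_n(\tilde{\mathcal{A}})=\{\sigma\in\mathcal{S}_n:\exists\,\pi\in\tilde{\mathcal{A}},\ \sigma\lhd\pi\}$. Every element of $res_n(\tilde{\mathcal{A}})$ equals $\psi(t)$ for a unique binary increasing tree $t$ with $n$ nodes. A left-to-right minimum of $\pi=\pi_1\cdots\pi_n$ is an entry $\pi_i$ with $\pi_i<\pi_j$ for all $j<i$. The min-path of a binary increasing tree is the sequence of nodes obtained by starting at the root and repeatedly moving to the child with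 the smallest label until a leaf is reached. -}

module Defs where

open import Data.Nat using (ℕ; zero; suc; _<_; _≤_; _≤?_; _<ᵇ_)
open import Data.Bool using (if_then_else_)
open import Data.List using (List; []; _∷_; _++_; [_]; map; upTo; filter)
open import Data.List.Relation.Unary.All using (All)
open import Data.List.Relation.Binary.Permutation.Propositional using (_↭_)
open import Data.Product using (Σ; ∃; _×_)
open import Data.Unit using (⊤)
open import Data.Empty using (⊥)
open import Relation.Binary.PropositionalEquality using (_≡_)

-- Children are unordered: 'binary x a b' and 'binary x b a' denote the same
-- tree; all functions below are invariant under this swap (for trees with
-- distinct labels), since the drawings order children by their labels.
data Tree : Set where
  leaf   : ℕ → Tree
  unary  : ℕ → Tree → Tree
  binary : ℕ → Tree → Tree → Tree

root : Tree → ℕ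
root (leaf x)       = x
root (unary x _)    = x
root (binary x _ _) = x

labels : Tree → List ℕ
labels (leaf x)       = [ x ]
labels (unary x c)    = x ∷ labels c
labels (binary x a b) = x ∷ (labels a ++ labels b)

Increasing : Tree → Set
Increasing (leaf x)       = ⊤
Increasing (unary x c)    = (x < root c) × Increasing c
Increasing (binary x a b) = (x < root a) × (x < root b) × Increasing a × Increasing b

StrictlyBinary : Tree → Set
StrictlyBinary (leaf x)       = ⊤
StrictlyBinary (unary x c)    = ⊥
StrictlyBinary (binary x a b) = StrictlyBinary a × StrictlyBinary b

range : ℕ → List ℕ
range n = map suc (upTo n)

BinIncTree : ℕ → Tree → Set
BinIncTree n t = Increasing t × (labels t ↭ range n)

IsPerm : ℕ → List ℕ → Set
IsPerm n π = π ↭ range n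

-- φ: in-order reading of the standard drawing
-- (two children: smaller-labelled on the left; one child: on the right)
φ : Tree → List ℕ
φ (leaf x)       = [ x ]
φ (unary x c)    = x ∷ φ c
φ (binary x a b) =
  if root a <ᵇ root b then φ a ++ (x ∷ φ b) else φ b ++ (x ∷ φ a)

-- ψ: in-order reading of the left-oriented drawing
-- (two children: smaller-labelled on the left; one child: on the left)
ψ : Tree → List ℕ
ψ (leaf x)       = [ x ]
ψ (unary x c)    = ψ c ++ [ x ]
ψ (binary x a b) =
  if root a <ᵇ root b then ψ a ++ (x ∷ ψ b) else ψ b ++ (x ∷ ψ a)

restrict : ℕ → List ℕ → List ℕ
restrict k π = filter (_≤? k) π

_◁_ : List ℕ → List ℕ → Set
σ ◁ π = Σ ℕ λ N → Σ ℕ λ n → IsPerm N π × (1 ≤ n) × (n ≤ N) × IsPerm n σ × (σ ≡ restrict n π)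

InAtilde : List ℕ → Set
InAtilde π = ∃ λ N → ∃ λ t → BinIncTree N t × StrictlyBinary t × (π ≡ φ t)

InRes : ℕ → List ℕ → Set
InRes n σ = IsPerm n σ × (∃ λ π → InAtilde π × (σ ◁ π))

IsLRMin : List ℕ → ℕ → Set
IsLRMin π x = ∃ λ pre → ∃ λ suf → (π ≡ pre ++ (x ∷ suf)) × All (x <_) pre

minPath : Tree → List ℕ
minPath (leaf x)       = [ x ]
minPath (unary x c)    = x ∷ minPath c
minPath (binary x a b) =
  x ∷ (if root a <ᵇ root b then minPath a else minPath b)

-- In the left-oriented drawing a node x is read as  ψ(left part) x ψ(right part),
-- where the left part is the child subtree of smaller root (or the only child)
-- and every label below x exceeds x. Hence the left-to-right minima of ψ t are
-- those of the left part followed by x, and the left part is exactly the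
-- subtree into which the min-path continues.
module Submission where

open import Defs
open import Data.Nat using (ℕ; _≤_; _<_; _<ᵇ_)
open import Data.Nat.Properties using (<-trans; <-asym)
open import Data.Bool using (true; false)
open import Data.List using (List; []; _∷_; _++_)
open import Data.List.Properties using (++-assoc; ∷-injective)
open import Data.List.Membership.Propositional using (_∈_)
open import Data.List.Membership.Propositional.Properties using (∈-++⁺ʳ)
open import Data.List.Relation.Unary.Any using (here; there)
open import Data.List.Relation.Unary.All as All using (All; []; _∷_)
open import Data.List.Relation.Unary.All.Properties using (++⁺)
open import Data.Product using (_×_; _,_)
open import Data.Sum using (_⊎_; inj₁; inj₂)
open import Data.Empty using (⊥-elim)
open import Function using (_∘_)
open import Function.Bundles using (_⇔_; mk⇔; Equivalence)
open import Relation.Nullary using (¬_)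
open import Relation.Binary.PropositionalEquality using (_≡_; refl; cong)

IsLRMin-[] : ∀ {y} → ¬ IsLRMin [] y
IsLRMin-[] ([]    , _ , () , _)
IsLRMin-[] (_ ∷ _ , _ , () , _)

IsLRMin-++ʳ : ∀ {xs : List ℕ} {y} zs → IsLRMin xs y → IsLRMin (xs ++ zs) y
IsLRMin-++ʳ zs (pre , suf , refl , y<pre) = pre , suf ++ zs , ++-assoc pre (_ ∷ suf) zs , y<pre

IsLRMin-pivot⁻ : ∀ {x y : ℕ} xs {ys} → All (x <_) ys →
  IsLRMin (xs ++ x ∷ ys) y → IsLRMin xs y ⊎ y ≡ x
IsLRMin-pivot⁻ []       _    ([]      , _ , refl , _) = inj₂ refl
IsLRMin-pivot⁻ []       x<ys (_ ∷ pre , _ , refl , y<x ∷ _) =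
  ⊥-elim (<-asym y<x (All.lookup x<ys (∈-++⁺ʳ pre (here refl))))
IsLRMin-pivot⁻ (_ ∷ xs) _    ([]      , _ , refl , _) = inj₁ ([] , xs , refl , [])
IsLRMin-pivot⁻ (z ∷ xs) x<ys (_ ∷ pre , suf , eq , y<z ∷ y<pre) with ∷-injective eq
... | refl , eq′ with IsLRMin-pivot⁻ xs x<ys (pre , suf , eq′ , y<pre)
...   | inj₂ y≡x = inj₂ y≡x
...   | inj₁ (pre′ , suf′ , e , y<pre′) = inj₁ (z ∷ pre′ , suf′ , cong (z ∷_) e , y<z ∷ y<pre′)

IsLRMin-pivot : ∀ {x : ℕ} {xs ys} → All (x <_) xs → All (x <_) ys → (l : List ℕ) →
  (∀ y → IsLRMin xs y ⇔ y ∈ l) → ∀ y → IsLRMin (xs ++ x ∷ ys) y ⇔ y ∈ x ∷ l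
IsLRMin-pivot {x} {xs} {ys} x<xs x<ys l lrMin⇔l y = mk⇔ to from
  where
  open Equivalence (lrMin⇔l y) renaming (to to toˡ; from to fromˡ)

  to : IsLRMin (xs ++ x ∷ ys) y → y ∈ x ∷ l
  to m with IsLRMin-pivot⁻ xs x<ys m
  ... | inj₁ m′  = there (toˡ m′)
  ... | inj₂ y≡x = here y≡x

  from : y ∈ x ∷ l → IsLRMin (xs ++ x ∷ ys) y
  from (here refl) = xs , ys , refl , x<xs
  from (there y∈l) = IsLRMin-++ʳ (x ∷ ys) (fromˡ y∈l)

ψ-above : ∀ {x} t → Increasing t → x < root t → All (x <_) (ψ t)
ψ-above (leaf _) _ x<r = x<r ∷ []
ψ-above (unary _ c) (r<c , inc-c) x<r = ++⁺ (ψ-above c inc-c (<-trans x<r r<c)) (x<r ∷ [])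
ψ-above (binary _ a b) (r<a , r<b , inc-a , inc-b) x<r
  with above-a ← ψ-above a inc-a (<-trans x<r r<a)
     | above-b ← ψ-above b inc-b (<-trans x<r r<b)
     | root a <ᵇ root b
... | true  = ++⁺ above-a (x<r ∷ above-b)
... | false = ++⁺ above-b (x<r ∷ above-a)

IsLRMin-ψ⇔minPath : ∀ t → Increasing t → ∀ y → IsLRMin (ψ t) y ⇔ y ∈ minPath t
IsLRMin-ψ⇔minPath (leaf _) _ =
  IsLRMin-pivot [] [] [] (λ _ → mk⇔ (⊥-elim ∘ IsLRMin-[]) λ ())
IsLRMin-ψ⇔minPath (unary _ c) (r<c , inc-c) =
  IsLRMin-pivot (ψ-above c inc-c r<c) [] (minPath c) (IsLRMin-ψ⇔minPath c inc-c)
IsLRMin-ψ⇔minPath (binary _ a b) (r<a , r<b , inc-a , inc-b) with root a <ᵇ root b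
... | true  = IsLRMin-pivot (ψ-above a inc-a r<a) (ψ-above b inc-b r<b)
                (minPath a) (IsLRMin-ψ⇔minPath a inc-a)
... | false = IsLRMin-pivot (ψ-above b inc-b r<b) (ψ-above a inc-a r<a)
                (minPath b) (IsLRMin-ψ⇔minPath b inc-b)

proposition2 : (n : ℕ) → 1 ≤ n → (π : List ℕ) → InRes n π →
    (t : Tree) → BinIncTree n t → ψ t ≡ π →
    (x : ℕ) → (IsLRMin π x → x ∈ minPath t) × (x ∈ minPath t → IsLRMin π x)
proposition2 _ _ _ _ t (inc , _) refl x = to , from
  where open Equivalence (IsLRMin-ψ⇔minPath t inc x)
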